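{- Let $g(x),f(x)$ be formal power series with integer coefficients and $g(0)=f(0)=1$, let $a_{n,k}=[x^n]g(x)(xf(x))^k$, let $\phi(x)$ be the reversion of $x/f(x)$, and let $s(x)$ be the reversion of $\phi(x)f(\phi(x))$. For an integer $r\ge0$ let $c(A;r)$ be the lower-triangular matrix with $(n,k)$ entry $a_{2n+r,n+k+r}$. Then $$c(A;r)^{ -1}\cdot c(A;r+1)=\left(\frac{x}{\phi(s(x))},\ x\right)\quad\text{and}\quad c(A;r+1)\cdot c(A;r)^{ -1}=(f(\phi(x)),\ x).$$
   Context: A Riordan array $(d(x),h(x))$, for formal power series $d,h$ with $d(0)\neq 0$, $h(0)=0$, $h'(0)\neq 0$, is the infinite lower-triangular matrix whose $(n,k)$ entry is $[x^n]d(x)h(x)^k$. Riordan arrays form a group under matrix multiplication, with $(d,h)\cdot(u,w)=(d(x)u(h(x)),w(h(x)))$ and $(d,h)^{ -1}=(1/d(\bar h),\bar h)$, where $\bar h$ is the reversion of $h$: the power series $u$ with $u(0)=0$ and $h(u(x))=x$. -}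

module Defs where

open import Data.Nat using (ℕ; zero; suc; _∸_; _<_) renaming (_+_ to _+ℕ_; _*_ to _*ℕ_)
open import Data.Integer using (ℤ; 0ℤ; 1ℤ; _+_; _*_)
open import Data.Product using (Σ; _×_)
open import Relation.Binary.PropositionalEquality using (_≡_)

-- Formal power series with integer coefficients: n ↦ [x^n] p.
FPS : Set
FPS = ℕ → ℤ

sumUpTo : ℕ → (ℕ → ℤ) → ℤ
sumUpTo zero    f = f 0
sumUpTo (suc n) f = sumUpTo n f + f (suc n)

_≈ₛ_ : FPS → FPS → Set
p ≈ₛ q = ∀ n → p n ≡ q n

oneS : FPS
oneS zero    = 1ℤ
oneS (suc _) = 0ℤ

X : FPS
X 1 = 1ℤ
X _ = 0ℤ

_⊛_ : FPS → FPS → FPS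
(p ⊛ q) n = sumUpTo n (λ i → p i * q (n ∸ i))

pow : FPS → ℕ → FPS
pow h zero    = oneS
pow h (suc k) = h ⊛ pow h k

-- composition g(h(x)), meaningful when h(0) = 0
comp : FPS → FPS → FPS
comp g h n = sumUpTo n (λ k → g k * pow h k n)

IsReversion : FPS → FPS → Set
IsReversion u h = (u 0 ≡ 0ℤ) × (comp h u ≈ₛ X)

-- infinite matrices (row n, column k)
Matrix : Set
Matrix = ℕ → ℕ → ℤ

_≈ₘ_ : Matrix → Matrix → Set
M ≈ₘ N = ∀ n k → M n k ≡ N n k

LowerTriangular : Matrix → Set
LowerTriangular M = ∀ n k → n < k → M n k ≡ 0ℤ

-- product of lower-triangular matrices (entries with j > n of M vanish)
_·_ : Matrix → Matrix → Matrix
(M · N) n k = sumUpTo n (λ j → M n j * N j k)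

idM : Matrix
idM zero    zero    = 1ℤ
idM (suc n) (suc k) = idM n k
idM _       _       = 0ℤ

riordan : FPS → FPS → Matrix
riordan d h n k = (d ⊛ pow h k) n

cMat : Matrix → ℕ → Matrix
cMat A r n k = A (2 *ℕ n +ℕ r) (n +ℕ k +ℕ r)

module Submission where

-- Put y = x f and T = (q, x).  The reversion identities give q(y) = f, so the fundamental theorem of
-- Riordan arrays yields c(A;r) · T = c(A;r+1) for every r.  Since c(A;r+2) is c(A;r) with its first
-- row and column deleted, c(A;r) obeys c(n+1,k+1) = (c · T · T)(n,k).  With H = φ f(φ) we have
-- q(H) = f(φ) and H = x f(φ)², so every Riordan array (d, H) obeys the same recurrence; comparing
-- first rows and columns, c(A;r) = (d, H) where d is its first column.  Its inverse is (1/d(s), s),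
-- and c(A;r+1) = (d f(φ), H), whence both products are read off from the Riordan group law, using
-- f(φ(s)) = x/φ(s) = q.

open import Defs
open import Data.Nat using (ℕ; zero; suc; z≤n; s≤s; _∸_) renaming (_+_ to _+ℕ_; _*_ to _*ℕ_; _≤_ to _≤ℕ_; _<_ to _<ℕ_)
import Data.Nat as ℕ
import Data.Nat.Properties as ℕP
open import Data.Integer using (ℤ; 0ℤ; 1ℤ; _+_; _*_; -_; _-_)
import Data.Integer.Properties as ℤP
open import Data.Product using (Σ; _×_; _,_; proj₁; proj₂)
open import Data.Sum using (inj₁; inj₂)
open import Relation.Binary.PropositionalEquality
open import Relation.Nullary using (yes; no)
open import Data.Empty using (⊥-elim)
open import Level using (0ℓ)
open import Relation.Binary.Bundles using (Setoid)
open import Algebra.Bundles using (CommutativeMonoid)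
import Algebra.Properties.CommutativeSemigroup as CommutativeSemigroupProperties
import Relation.Binary.Reasoning.Setoid as SetoidReasoning
open import Data.Nat.Induction using (<-rec)
open import Data.Nat.Tactic.RingSolver using (solve-∀)

open CommutativeSemigroupProperties ℤP.+-commutativeSemigroup using () renaming (interchange to +-interchange)
open CommutativeSemigroupProperties ℤP.*-commutativeSemigroup using () renaming (x∙yz≈y∙xz to *-leftComm; xy∙z≈yz∙x to *-rotate)

-- Finite sums

*-zeroʳ-≡ : ∀ x {y} → y ≡ 0ℤ → x * y ≡ 0ℤ
*-zeroʳ-≡ x refl = ℤP.*-zeroʳ x

*-zeroˡ-≡ : ∀ {x} y → x ≡ 0ℤ → x * y ≡ 0ℤ
*-zeroˡ-≡ y refl = refl

sumUpTo-cong : ∀ n {f g : ℕ → ℤ} → (∀ i → i ≤ℕ n → f i ≡ g i) → sumUpTo n f ≡ sumUpTo n g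
sumUpTo-cong zero    f≗g = f≗g 0 z≤n
sumUpTo-cong (suc n) f≗g =
  cong₂ _+_ (sumUpTo-cong n (λ i i≤n → f≗g i (ℕP.m≤n⇒m≤1+n i≤n))) (f≗g (suc n) ℕP.≤-refl)

sumUpTo-cong′ : ∀ n {f g : ℕ → ℤ} → (∀ i → f i ≡ g i) → sumUpTo n f ≡ sumUpTo n g
sumUpTo-cong′ n f≗g = sumUpTo-cong n (λ i _ → f≗g i)

sumUpTo-zero : ∀ n {f : ℕ → ℤ} → (∀ i → i ≤ℕ n → f i ≡ 0ℤ) → sumUpTo n f ≡ 0ℤ
sumUpTo-zero n f≗0 = trans (sumUpTo-cong n f≗0) (sumUpTo-const0 n)
  where
  sumUpTo-const0 : ∀ n → sumUpTo n (λ _ → 0ℤ) ≡ 0ℤ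
  sumUpTo-const0 zero    = refl
  sumUpTo-const0 (suc n) = cong (_+ 0ℤ) (sumUpTo-const0 n)

sumUpTo-+ : ∀ n (f g : ℕ → ℤ) → sumUpTo n (λ i → f i + g i) ≡ sumUpTo n f + sumUpTo n g
sumUpTo-+ zero    f g = refl
sumUpTo-+ (suc n) f g = trans (cong (_+ (f (suc n) + g (suc n))) (sumUpTo-+ n f g))
  (+-interchange (sumUpTo n f) (sumUpTo n g) (f (suc n)) (g (suc n)))

sumUpTo-neg : ∀ n (f : ℕ → ℤ) → sumUpTo n (λ i → - f i) ≡ - sumUpTo n f
sumUpTo-neg zero    f = refl
sumUpTo-neg (suc n) f = trans (cong (_+ (- f (suc n))) (sumUpTo-neg n f))
  (sym (ℤP.neg-distrib-+ (sumUpTo n f) (f (suc n))))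

*-sumUpTo : ∀ n (c : ℤ) (f : ℕ → ℤ) → c * sumUpTo n f ≡ sumUpTo n (λ i → c * f i)
*-sumUpTo zero    c f = refl
*-sumUpTo (suc n) c f = trans (ℤP.*-distribˡ-+ c (sumUpTo n f) (f (suc n)))
  (cong (_+ (c * f (suc n))) (*-sumUpTo n c f))

sumUpTo-* : ∀ n (c : ℤ) (f : ℕ → ℤ) → sumUpTo n f * c ≡ sumUpTo n (λ i → f i * c)
sumUpTo-* n c f = trans (ℤP.*-comm (sumUpTo n f) c)
  (trans (*-sumUpTo n c f) (sumUpTo-cong′ n (λ i → ℤP.*-comm c (f i))))

sumUpTo-extend : ∀ m n {f : ℕ → ℤ} → m ≤ℕ n → (∀ i → m <ℕ i → i ≤ℕ n → f i ≡ 0ℤ) →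
  sumUpTo n f ≡ sumUpTo m f
sumUpTo-extend m zero    z≤n f≗0 = refl
sumUpTo-extend m (suc n) {f} m≤1+n f≗0 with ℕP.m≤n⇒m<n∨m≡n m≤1+n
... | inj₂ refl = refl
... | inj₁ m<1+n = begin
    sumUpTo n f + f (suc n)
  ≡⟨ cong₂ _+_ (sumUpTo-extend m n (ℕP.≤-pred m<1+n) (λ i m<i i≤n → f≗0 i m<i (ℕP.m≤n⇒m≤1+n i≤n)))
               (f≗0 (suc n) m<1+n ℕP.≤-refl) ⟩
    sumUpTo m f + 0ℤ
  ≡⟨ ℤP.+-identityʳ _ ⟩
    sumUpTo m f ∎
  where open ≡-Reasoning

sumUpTo-swap : ∀ m n (F : ℕ → ℕ → ℤ) →
  sumUpTo m (λ i → sumUpTo n (F i)) ≡ sumUpTo n (λ j → sumUpTo m (λ i → F i j))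
sumUpTo-swap zero    n F = refl
sumUpTo-swap (suc m) n F = trans (cong (_+ sumUpTo n (F (suc m))) (sumUpTo-swap m n F))
  (sym (sumUpTo-+ n (λ j → sumUpTo m (λ i → F i j)) (F (suc m))))

sumUpTo-suc : ∀ n (f : ℕ → ℤ) → sumUpTo (suc n) f ≡ f 0 + sumUpTo n (λ i → f (suc i))
sumUpTo-suc zero    f = refl
sumUpTo-suc (suc n) f = trans (cong (_+ f (suc (suc n))) (sumUpTo-suc n f)) (ℤP.+-assoc (f 0) _ _)

sumUpTo-reverse : ∀ n (f : ℕ → ℤ) → sumUpTo n f ≡ sumUpTo n (λ i → f (n ∸ i))
sumUpTo-reverse zero    f = refl
sumUpTo-reverse (suc n) f = begin
    sumUpTo (suc n) f
  ≡⟨ sumUpTo-suc n f ⟩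
    f 0 + sumUpTo n (λ i → f (suc i))
  ≡⟨ cong (f 0 +_) (sumUpTo-reverse n (λ i → f (suc i))) ⟩
    f 0 + sumUpTo n (λ i → f (suc (n ∸ i)))
  ≡⟨ ℤP.+-comm (f 0) _ ⟩
    sumUpTo n (λ i → f (suc (n ∸ i))) + f 0
  ≡⟨ cong₂ _+_ (sumUpTo-cong n (λ i i≤n → cong f (sym (ℕP.+-∸-assoc 1 i≤n))))
               (cong f (sym (ℕP.n∸n≡0 n))) ⟩
    sumUpTo (suc n) (λ i → f (suc n ∸ i)) ∎
  where open ≡-Reasoning

sumUpTo-triangle : ∀ n (F : ℕ → ℕ → ℤ) →
  sumUpTo n (λ k → sumUpTo k (λ i → F i k)) ≡ sumUpTo n (λ i → sumUpTo (n ∸ i) (λ j → F i (i +ℕ j)))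
sumUpTo-triangle zero    F = refl
sumUpTo-triangle (suc n) F = begin
    sumUpTo n (λ k → sumUpTo k (λ i → F i k)) + (sumUpTo n (λ i → F i (suc n)) + F (suc n) (suc n))
  ≡⟨ cong (_+ (sumUpTo n (λ i → F i (suc n)) + F (suc n) (suc n))) (sumUpTo-triangle n F) ⟩
    Rₙ + (sumUpTo n (λ i → F i (suc n)) + F (suc n) (suc n))
  ≡⟨ ℤP.+-assoc Rₙ _ _ ⟨
    (Rₙ + sumUpTo n (λ i → F i (suc n))) + F (suc n) (suc n)
  ≡⟨ cong₂ _+_ (trans (sym (sumUpTo-+ n _ _)) (sumUpTo-cong n row))
               (trans (cong (F (suc n)) (sym (ℕP.+-identityʳ (suc n))))
                      (cong (λ m → sumUpTo m (λ j → F (suc n) (suc n +ℕ j))) (sym (ℕP.n∸n≡0 n)))) ⟩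
    sumUpTo (suc n) (λ i → sumUpTo (suc n ∸ i) (λ j → F i (i +ℕ j))) ∎
  where
  open ≡-Reasoning
  Rₙ = sumUpTo n (λ i → sumUpTo (n ∸ i) (λ j → F i (i +ℕ j)))
  row : ∀ i → i ≤ℕ n →
    sumUpTo (n ∸ i) (λ j → F i (i +ℕ j)) + F i (suc n) ≡ sumUpTo (suc n ∸ i) (λ j → F i (i +ℕ j))
  row i i≤n rewrite ℕP.+-∸-assoc 1 i≤n =
    cong (λ m → sumUpTo (n ∸ i) (λ j → F i (i +ℕ j)) + F i m)
         (sym (trans (ℕP.+-suc i (n ∸ i)) (cong suc (ℕP.m+[n∸m]≡n i≤n))))

sumUpTo-single : ∀ n c {f : ℕ → ℤ} → c ≤ℕ n → (∀ i → i ≤ℕ n → i ≢ c → f i ≡ 0ℤ) → sumUpTo n f ≡ f c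
sumUpTo-single zero    zero    z≤n f≗0 = refl
sumUpTo-single (suc n) c {f} c≤1+n f≗0 with c ℕ.≟ suc n
... | yes refl = trans (cong (_+ f (suc n)) (sumUpTo-zero n (λ i i≤n → f≗0 i (ℕP.m≤n⇒m≤1+n i≤n)
        (λ i≡1+n → ℕP.<-irrefl i≡1+n (s≤s i≤n))))) (ℤP.+-identityˡ _)
... | no c≢1+n = trans (cong₂ _+_ (sumUpTo-single n c (ℕP.≤-pred (ℕP.≤∧≢⇒< c≤1+n c≢1+n))
                                     (λ i i≤n → f≗0 i (ℕP.m≤n⇒m≤1+n i≤n)))
                                  (f≗0 (suc n) ℕP.≤-refl (λ e → c≢1+n (sym e))))
                       (ℤP.+-identityʳ _)

sumUpTo-cancel-except : ∀ n c {f g : ℕ → ℤ} → c ≤ℕ n → (∀ i → i ≤ℕ n → i ≢ c → f i ≡ g i) →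
  sumUpTo n f ≡ sumUpTo n g → f c ≡ g c
sumUpTo-cancel-except n c {f} {g} c≤n f≗g Σf≡Σg = ℤP.i-j≡0⇒i≡j (f c) (g c) (begin
    f c - g c
  ≡⟨ sumUpTo-single n c c≤n (λ i i≤n i≢c → ℤP.i≡j⇒i-j≡0 (f≗g i i≤n i≢c)) ⟨
    sumUpTo n (λ i → f i - g i)
  ≡⟨ sumUpTo-+ n f (λ i → - g i) ⟩
    sumUpTo n f + sumUpTo n (λ i → - g i)
  ≡⟨ cong₂ (λ a b → a + b) Σf≡Σg (sumUpTo-neg n g) ⟩
    sumUpTo n g - sumUpTo n g
  ≡⟨ ℤP.+-inverseʳ (sumUpTo n g) ⟩
    0ℤ ∎)
  where open ≡-Reasoning

-- Formal power series

≈ₛ-setoid : Setoid 0ℓ 0ℓ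
≈ₛ-setoid = record
  { Carrier       = FPS
  ; _≈_           = _≈ₛ_
  ; isEquivalence = record
    { refl  = λ n → refl
    ; sym   = λ p≈q n → sym (p≈q n)
    ; trans = λ p≈q q≈r n → trans (p≈q n) (q≈r n)
    }
  }

open Setoid ≈ₛ-setoid using () renaming (refl to ≈ₛ-refl; sym to ≈ₛ-sym; trans to ≈ₛ-trans)
module ≈ₛ-Reasoning = SetoidReasoning ≈ₛ-setoid

⊛-cong : ∀ {a a′ b b′ : FPS} → a ≈ₛ a′ → b ≈ₛ b′ → (a ⊛ b) ≈ₛ (a′ ⊛ b′)
⊛-cong a≈a′ b≈b′ n = sumUpTo-cong′ n (λ i → cong₂ _*_ (a≈a′ i) (b≈b′ (n ∸ i)))

⊛-congˡ : ∀ (a : FPS) {b b′ : FPS} → b ≈ₛ b′ → (a ⊛ b) ≈ₛ (a ⊛ b′)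
⊛-congˡ a = ⊛-cong (≈ₛ-refl {a})

⊛-congʳ : ∀ (b : FPS) {a a′ : FPS} → a ≈ₛ a′ → (a ⊛ b) ≈ₛ (a′ ⊛ b)
⊛-congʳ b a≈a′ = ⊛-cong a≈a′ (≈ₛ-refl {b})

⊛-comm : ∀ (a b : FPS) → (a ⊛ b) ≈ₛ (b ⊛ a)
⊛-comm a b n = trans (sumUpTo-reverse n (λ i → a i * b (n ∸ i)))
  (sumUpTo-cong n (λ i i≤n → trans (cong (λ m → a (n ∸ i) * b m) (ℕP.m∸[m∸n]≡n i≤n))
                                    (ℤP.*-comm (a (n ∸ i)) (b i))))

⊛-assoc : ∀ (a b c : FPS) → ((a ⊛ b) ⊛ c) ≈ₛ (a ⊛ (b ⊛ c))
⊛-assoc a b c n = begin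
    sumUpTo n (λ k → sumUpTo k (λ i → a i * b (k ∸ i)) * c (n ∸ k))
  ≡⟨ sumUpTo-cong′ n (λ k → sumUpTo-* k (c (n ∸ k)) (λ i → a i * b (k ∸ i))) ⟩
    sumUpTo n (λ k → sumUpTo k (λ i → a i * b (k ∸ i) * c (n ∸ k)))
  ≡⟨ sumUpTo-triangle n (λ i k → a i * b (k ∸ i) * c (n ∸ k)) ⟩
    sumUpTo n (λ i → sumUpTo (n ∸ i) (λ j → a i * b ((i +ℕ j) ∸ i) * c (n ∸ (i +ℕ j))))
  ≡⟨ sumUpTo-cong′ n (λ i → sumUpTo-cong′ (n ∸ i) (λ j →
       trans (cong₂ (λ u v → a i * b u * c v) (ℕP.m+n∸m≡n i j) (sym (ℕP.∸-+-assoc n i j)))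
             (ℤP.*-assoc (a i) (b j) (c (n ∸ i ∸ j))))) ⟩
    sumUpTo n (λ i → sumUpTo (n ∸ i) (λ j → a i * (b j * c (n ∸ i ∸ j))))
  ≡⟨ sumUpTo-cong′ n (λ i → *-sumUpTo (n ∸ i) (a i) _) ⟨
    sumUpTo n (λ i → a i * sumUpTo (n ∸ i) (λ j → b j * c (n ∸ i ∸ j))) ∎
  where open ≡-Reasoning

⊛-identityˡ : ∀ (a : FPS) → (oneS ⊛ a) ≈ₛ a
⊛-identityˡ a n = trans (sumUpTo-single n 0 z≤n vanish) (ℤP.*-identityˡ (a n))
  where
  vanish : ∀ i → i ≤ℕ n → i ≢ 0 → oneS i * a (n ∸ i) ≡ 0ℤ
  vanish zero    _ 0≢0 = ⊥-elim (0≢0 refl)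
  vanish (suc i) _ _   = refl

⊛-identityʳ : ∀ (a : FPS) → (a ⊛ oneS) ≈ₛ a
⊛-identityʳ a = ≈ₛ-trans (⊛-comm a oneS) (⊛-identityˡ a)

⊛-commutativeMonoid : CommutativeMonoid 0ℓ 0ℓ
⊛-commutativeMonoid = record
  { Carrier             = FPS
  ; _≈_                 = _≈ₛ_
  ; _∙_                 = _⊛_
  ; ε                   = oneS
  ; isCommutativeMonoid = record
    { isMonoid = record
      { isSemigroup = record
        { isMagma = record { isEquivalence = Setoid.isEquivalence ≈ₛ-setoid ; ∙-cong = ⊛-cong }
        ; assoc   = ⊛-assoc
        }
      ; identity = ⊛-identityˡ , ⊛-identityʳ
      }
    ; comm = ⊛-comm
    }
  }

open CommutativeSemigroupProperties (CommutativeMonoid.commutativeSemigroup ⊛-commutativeMonoid)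
  using (x∙yz≈y∙xz; x∙yz≈xz∙y; xy∙z≈zx∙y)

X⊛-suc : ∀ (a : FPS) n → (X ⊛ a) (suc n) ≡ a n
X⊛-suc a n = trans (sumUpTo-single (suc n) 1 (s≤s z≤n) vanish) (ℤP.*-identityˡ (a n))
  where
  vanish : ∀ i → i ≤ℕ suc n → i ≢ 1 → X i * a (suc n ∸ i) ≡ 0ℤ
  vanish zero          _ _   = refl
  vanish (suc zero)    _ 1≢1 = ⊥-elim (1≢1 refl)
  vanish (suc (suc i)) _ _   = refl

X⊛-cancel : ∀ {a b : FPS} → (X ⊛ a) ≈ₛ (X ⊛ b) → a ≈ₛ b
X⊛-cancel {a} {b} Xa≈Xb n = trans (sym (X⊛-suc a n)) (trans (Xa≈Xb (suc n)) (X⊛-suc b n))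

⊛-coeff-1 : ∀ {a : FPS} (b : FPS) → a 0 ≡ 0ℤ → (a ⊛ b) 1 ≡ a 1 * b 0
⊛-coeff-1 {a} b a₀≡0 = trans (cong (_+ (a 1 * b 0)) (*-zeroˡ-≡ (b 1) a₀≡0)) (ℤP.+-identityˡ _)

⊛-scaleʳ : ∀ (a b : FPS) (c : ℤ) n → (a ⊛ (λ m → c * b m)) n ≡ c * (a ⊛ b) n
⊛-scaleʳ a b c n = trans (sumUpTo-cong′ n (λ i → *-leftComm (a i) c (b (n ∸ i)))) (sym (*-sumUpTo n c _))

pow-cong : ∀ {h h′ : FPS} → h ≈ₛ h′ → ∀ k → pow h k ≈ₛ pow h′ k
pow-cong h≈h′ zero    = ≈ₛ-refl
pow-cong h≈h′ (suc k) = ⊛-cong h≈h′ (pow-cong h≈h′ k)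

pow-+ : ∀ (h : FPS) j k → pow h (j +ℕ k) ≈ₛ (pow h j ⊛ pow h k)
pow-+ h zero    k = ≈ₛ-sym (⊛-identityˡ (pow h k))
pow-+ h (suc j) k = ≈ₛ-trans (⊛-congˡ h (pow-+ h j k)) (≈ₛ-sym (⊛-assoc h (pow h j) (pow h k)))

∸-suc-< : ∀ {n} i → suc i ≤ℕ n → n ∸ suc i <ℕ n
∸-suc-< {suc n} i _ = s≤s (ℕP.m∸n≤m n i)

pow-vanishes : ∀ {h : FPS} → h 0 ≡ 0ℤ → ∀ k n → n <ℕ k → pow h k n ≡ 0ℤ
pow-vanishes {h} h₀≡0 (suc k) n n<1+k = sumUpTo-zero n vanish
  where
  vanish : ∀ i → i ≤ℕ n → h i * pow h k (n ∸ i) ≡ 0ℤ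
  vanish zero    _       = *-zeroˡ-≡ (pow h k n) h₀≡0
  vanish (suc i) 1+i≤n = *-zeroʳ-≡ (h (suc i))
    (pow-vanishes h₀≡0 k (n ∸ suc i) (ℕP.<-≤-trans (∸-suc-< i 1+i≤n) (ℕP.≤-pred n<1+k)))

⊛-pow-vanishes : ∀ {h : FPS} → h 0 ≡ 0ℤ → ∀ (a : FPS) k n → n <ℕ k → (a ⊛ pow h k) n ≡ 0ℤ
⊛-pow-vanishes h₀≡0 a k n n<k = sumUpTo-zero n (λ i _ →
  *-zeroʳ-≡ (a i) (pow-vanishes h₀≡0 k (n ∸ i) (ℕP.≤-<-trans (ℕP.m∸n≤m n i) n<k)))

⊛-pow-diagonal : ∀ {h : FPS} → h 0 ≡ 0ℤ → ∀ (a : FPS) k → (a ⊛ pow h k) k ≡ a 0 * pow h k k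
⊛-pow-diagonal {h} h₀≡0 a k = sumUpTo-single k 0 z≤n vanish
  where
  vanish : ∀ i → i ≤ℕ k → i ≢ 0 → a i * pow h k (k ∸ i) ≡ 0ℤ
  vanish zero    _       0≢0 = ⊥-elim (0≢0 refl)
  vanish (suc i) 1+i≤k _   = *-zeroʳ-≡ (a (suc i)) (pow-vanishes h₀≡0 k (k ∸ suc i) (∸-suc-< i 1+i≤k))

pow-diagonal : ∀ {h : FPS} → h 0 ≡ 0ℤ → h 1 ≡ 1ℤ → ∀ k → pow h k k ≡ 1ℤ
pow-diagonal h₀≡0 h₁≡1 zero    = refl
pow-diagonal {h} h₀≡0 h₁≡1 (suc k) =
  trans (sumUpTo-single (suc k) 1 (s≤s z≤n) vanish) (cong₂ _*_ h₁≡1 (pow-diagonal h₀≡0 h₁≡1 k))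
  where
  vanish : ∀ i → i ≤ℕ suc k → i ≢ 1 → h i * pow h k (suc k ∸ i) ≡ 0ℤ
  vanish zero          _           _   = *-zeroˡ-≡ _ h₀≡0
  vanish (suc zero)    _           1≢1 = ⊥-elim (1≢1 refl)
  vanish (suc (suc i)) (s≤s 1+i≤k) _   =
    *-zeroʳ-≡ (h (suc (suc i))) (pow-vanishes h₀≡0 k (k ∸ suc i) (∸-suc-< i 1+i≤k))

-- Stage n of the recursive computation of 1/u: its coefficients 0..n are final, the others are junk.
invApprox : FPS → ℕ → FPS
invApprox u zero    i = 1ℤ
invApprox u (suc n) i with i ℕ.≤? n
... | yes _ = invApprox u n i
... | no  _ = - sumUpTo n (λ j → invApprox u n j * u (suc n ∸ j))

inv : FPS → FPS
inv u n = invApprox u n n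

invApprox-suc : ∀ u {n i} → i ≤ℕ n → invApprox u (suc n) i ≡ invApprox u n i
invApprox-suc u {n} {i} i≤n with i ℕ.≤? n
... | yes _   = refl
... | no  i≰n = ⊥-elim (i≰n i≤n)

invApprox-stable : ∀ u n i → i ≤ℕ n → invApprox u n i ≡ inv u i
invApprox-stable u zero    zero z≤n = refl
invApprox-stable u (suc n) i i≤1+n with ℕP.m≤n⇒m<n∨m≡n i≤1+n
... | inj₁ i<1+n = trans (invApprox-suc u (ℕP.≤-pred i<1+n)) (invApprox-stable u n i (ℕP.≤-pred i<1+n))
... | inj₂ refl  = refl

inv-suc : ∀ u n → inv u (suc n) ≡ - sumUpTo n (λ j → inv u j * u (suc n ∸ j))
inv-suc u n with suc n ℕ.≤? n
... | yes 1+n≤n = ⊥-elim (ℕP.<-irrefl refl 1+n≤n)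
... | no  _     = cong -_ (sumUpTo-cong n (λ j j≤n → cong (_* u (suc n ∸ j)) (invApprox-stable u n j j≤n)))

inv-⊛ : ∀ (u : FPS) → u 0 ≡ 1ℤ → (inv u ⊛ u) ≈ₛ oneS
inv-⊛ u u₀≡1 zero    = cong (1ℤ *_) u₀≡1
inv-⊛ u u₀≡1 (suc n) = begin
    S + inv u (suc n) * u (n ∸ n)
  ≡⟨ cong (S +_) (cong₂ _*_ (inv-suc u n) (trans (cong u (ℕP.n∸n≡0 n)) u₀≡1)) ⟩
    S + (- S) * 1ℤ
  ≡⟨ cong (S +_) (ℤP.*-identityʳ (- S)) ⟩
    S + - S
  ≡⟨ ℤP.+-inverseʳ S ⟩
    0ℤ ∎
  where
  open ≡-Reasoning
  S = sumUpTo n (λ i → inv u i * u (suc n ∸ i))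

⊛-cancelʳ : ∀ {a b u : FPS} → u 0 ≡ 1ℤ → (a ⊛ u) ≈ₛ (b ⊛ u) → a ≈ₛ b
⊛-cancelʳ {a} {b} {u} u₀≡1 a⊛u≈b⊛u = begin
    a                     ≈⟨ ⊛-identityʳ a ⟨
    a ⊛ oneS              ≈⟨ ⊛-congˡ a u⁻¹u≈1 ⟨
    a ⊛ (u ⊛ inv u)       ≈⟨ ⊛-assoc a u (inv u) ⟨
    (a ⊛ u) ⊛ inv u       ≈⟨ ⊛-congʳ (inv u) a⊛u≈b⊛u ⟩
    (b ⊛ u) ⊛ inv u       ≈⟨ ⊛-assoc b u (inv u) ⟩
    b ⊛ (u ⊛ inv u)       ≈⟨ ⊛-congˡ b u⁻¹u≈1 ⟩
    b ⊛ oneS              ≈⟨ ⊛-identityʳ b ⟩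
    b                     ∎
  where
  open ≈ₛ-Reasoning
  u⁻¹u≈1 : (u ⊛ inv u) ≈ₛ oneS
  u⁻¹u≈1 = ≈ₛ-trans (⊛-comm u (inv u)) (inv-⊛ u u₀≡1)

-- Composition and reversion

⊛-sumUpTo : ∀ (a : FPS) (F : ℕ → FPS) → (∀ k m → m <ℕ k → F k m ≡ 0ℤ) → ∀ n →
  (a ⊛ (λ m → sumUpTo m (λ k → F k m))) n ≡ sumUpTo n (λ k → (a ⊛ F k) n)
⊛-sumUpTo a F F-vanishes n = begin
    sumUpTo n (λ m → a m * sumUpTo (n ∸ m) (λ k → F k (n ∸ m)))
  ≡⟨ sumUpTo-cong′ n (λ m → *-sumUpTo (n ∸ m) (a m) _) ⟩
    sumUpTo n (λ m → sumUpTo (n ∸ m) (λ k → a m * F k (n ∸ m)))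
  ≡⟨ sumUpTo-cong′ n (λ m → sumUpTo-extend (n ∸ m) n (ℕP.m∸n≤m n m)
        (λ k n∸m<k _ → *-zeroʳ-≡ (a m) (F-vanishes k (n ∸ m) n∸m<k))) ⟨
    sumUpTo n (λ m → sumUpTo n (λ k → a m * F k (n ∸ m)))
  ≡⟨ sumUpTo-swap n n _ ⟩
    sumUpTo n (λ k → (a ⊛ F k) n) ∎
  where open ≡-Reasoning

⊛-comp : ∀ {h : FPS} → h 0 ≡ 0ℤ → ∀ (a c : FPS) n →
  (a ⊛ comp c h) n ≡ sumUpTo n (λ j → (a ⊛ pow h j) n * c j)
⊛-comp {h} h₀≡0 a c n =
  trans (⊛-sumUpTo a (λ j m → c j * pow h j m) (λ k m m<k → *-zeroʳ-≡ (c k) (pow-vanishes h₀≡0 k m m<k)) n)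
        (sumUpTo-cong′ n (λ j → trans (⊛-scaleʳ a (pow h j) (c j) n) (ℤP.*-comm (c j) _)))

comp-cong : ∀ {a a′ h h′ : FPS} → a ≈ₛ a′ → h ≈ₛ h′ → comp a h ≈ₛ comp a′ h′
comp-cong a≈a′ h≈h′ n = sumUpTo-cong′ n (λ k → cong₂ _*_ (a≈a′ k) (pow-cong h≈h′ k n))

comp-congˡ : ∀ (a : FPS) {h h′ : FPS} → h ≈ₛ h′ → comp a h ≈ₛ comp a h′
comp-congˡ a = comp-cong (≈ₛ-refl {a})

comp-congʳ : ∀ (h : FPS) {a a′ : FPS} → a ≈ₛ a′ → comp a h ≈ₛ comp a′ h
comp-congʳ h a≈a′ = comp-cong a≈a′ (≈ₛ-refl {h})

comp-coeff-0 : ∀ (a h : FPS) → comp a h 0 ≡ a 0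
comp-coeff-0 a h = ℤP.*-identityʳ (a 0)

oneS-comp : ∀ (h : FPS) → comp oneS h ≈ₛ oneS
oneS-comp h n = trans (sumUpTo-single n 0 z≤n vanish) (ℤP.*-identityˡ (oneS n))
  where
  vanish : ∀ i → i ≤ℕ n → i ≢ 0 → oneS i * pow h i n ≡ 0ℤ
  vanish zero    _ 0≢0 = ⊥-elim (0≢0 refl)
  vanish (suc i) _ _   = refl

X-comp : ∀ {h : FPS} → h 0 ≡ 0ℤ → comp X h ≈ₛ h
X-comp h₀≡0 zero    = sym h₀≡0
X-comp {h} h₀≡0 (suc n) =
  trans (sumUpTo-single (suc n) 1 (s≤s z≤n) vanish) (trans (ℤP.*-identityˡ _) (⊛-identityʳ h (suc n)))
  where
  vanish : ∀ i → i ≤ℕ suc n → i ≢ 1 → X i * pow h i (suc n) ≡ 0ℤ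
  vanish zero          _ _   = refl
  vanish (suc zero)    _ 1≢1 = ⊥-elim (1≢1 refl)
  vanish (suc (suc i)) _ _   = refl

pow-X : ∀ k n → pow X k n ≡ idM n k
pow-X zero    zero    = refl
pow-X zero    (suc n) = refl
pow-X (suc k) zero    = refl
pow-X (suc k) (suc n) = trans (X⊛-suc (pow X k) n) (pow-X k n)

idM-diagonal : ∀ n → idM n n ≡ 1ℤ
idM-diagonal zero    = refl
idM-diagonal (suc n) = idM-diagonal n

idM-offDiagonal : ∀ n k → n ≢ k → idM n k ≡ 0ℤ
idM-offDiagonal zero    zero    0≢0 = ⊥-elim (0≢0 refl)
idM-offDiagonal zero    (suc k) _   = refl
idM-offDiagonal (suc n) zero    _   = refl
idM-offDiagonal (suc n) (suc k) n≢k = idM-offDiagonal n k (λ n≡k → n≢k (cong suc n≡k))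

comp-X : ∀ (a : FPS) → comp a X ≈ₛ a
comp-X a n = trans (sumUpTo-single n n ℕP.≤-refl vanish)
  (trans (cong (a n *_) (trans (pow-X n n) (idM-diagonal n))) (ℤP.*-identityʳ (a n)))
  where
  vanish : ∀ i → i ≤ℕ n → i ≢ n → a i * pow X i n ≡ 0ℤ
  vanish i _ i≢n = *-zeroʳ-≡ (a i) (trans (pow-X i n) (idM-offDiagonal n i (λ n≡i → i≢n (sym n≡i))))

comp-⊛-coeff : ∀ {h : FPS} → h 0 ≡ 0ℤ → ∀ (a b : FPS) n →
  comp (a ⊛ b) h n ≡ sumUpTo n (λ i → sumUpTo n (λ j → (a i * b j) * pow h (i +ℕ j) n))
comp-⊛-coeff {h} h₀≡0 a b n = begin
    sumUpTo n (λ k → sumUpTo k (λ i → a i * b (k ∸ i)) * pow h k n)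
  ≡⟨ sumUpTo-cong′ n (λ k → sumUpTo-* k (pow h k n) (λ i → a i * b (k ∸ i))) ⟩
    sumUpTo n (λ k → sumUpTo k (λ i → a i * b (k ∸ i) * pow h k n))
  ≡⟨ sumUpTo-triangle n (λ i k → a i * b (k ∸ i) * pow h k n) ⟩
    sumUpTo n (λ i → sumUpTo (n ∸ i) (λ j → a i * b ((i +ℕ j) ∸ i) * pow h (i +ℕ j) n))
  ≡⟨ sumUpTo-cong′ n (λ i → sumUpTo-cong′ (n ∸ i) (λ j → cong (λ u → a i * b u * pow h (i +ℕ j) n) (ℕP.m+n∸m≡n i j))) ⟩
    sumUpTo n (λ i → sumUpTo (n ∸ i) (λ j → (a i * b j) * pow h (i +ℕ j) n))
  ≡⟨ sumUpTo-cong n (λ i i≤n → sumUpTo-extend (n ∸ i) n (ℕP.m∸n≤m n i) (λ j n∸i<j _ →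
       *-zeroʳ-≡ (a i * b j) (pow-vanishes h₀≡0 (i +ℕ j) n (i+j-large i≤n n∸i<j)))) ⟨
    sumUpTo n (λ i → sumUpTo n (λ j → (a i * b j) * pow h (i +ℕ j) n)) ∎
  where
  open ≡-Reasoning
  i+j-large : ∀ {i j} → i ≤ℕ n → n ∸ i <ℕ j → n <ℕ i +ℕ j
  i+j-large {i} i≤n n∸i<j = ℕP.≤-<-trans (ℕP.≤-reflexive (sym (ℕP.m+[n∸m]≡n i≤n))) (ℕP.+-monoʳ-< i n∸i<j)

comp⊛comp-coeff : ∀ {h : FPS} → h 0 ≡ 0ℤ → ∀ (a b : FPS) n →
  (comp a h ⊛ comp b h) n ≡ sumUpTo n (λ i → sumUpTo n (λ j → (a i * b j) * pow h (i +ℕ j) n))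
comp⊛comp-coeff {h} h₀≡0 a b n = begin
    (comp a h ⊛ comp b h) n
  ≡⟨ ⊛-comp h₀≡0 (comp a h) b n ⟩
    sumUpTo n (λ j → (comp a h ⊛ pow h j) n * b j)
  ≡⟨ sumUpTo-cong′ n (λ j → cong (_* b j) (trans (⊛-comm (comp a h) (pow h j) n) (⊛-comp h₀≡0 (pow h j) a n))) ⟩
    sumUpTo n (λ j → sumUpTo n (λ i → (pow h j ⊛ pow h i) n * a i) * b j)
  ≡⟨ sumUpTo-cong′ n (λ j → sumUpTo-* n (b j) _) ⟩
    sumUpTo n (λ j → sumUpTo n (λ i → (pow h j ⊛ pow h i) n * a i * b j))
  ≡⟨ sumUpTo-swap n n _ ⟩
    sumUpTo n (λ i → sumUpTo n (λ j → (pow h j ⊛ pow h i) n * a i * b j))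
  ≡⟨ sumUpTo-cong′ n (λ i → sumUpTo-cong′ n (λ j → trans (*-rotate _ (a i) (b j))
       (cong (a i * b j *_) (trans (sym (pow-+ h j i n)) (cong (λ m → pow h m n) (ℕP.+-comm j i)))))) ⟩
    sumUpTo n (λ i → sumUpTo n (λ j → (a i * b j) * pow h (i +ℕ j) n)) ∎
  where open ≡-Reasoning

comp-⊛ : ∀ {h : FPS} → h 0 ≡ 0ℤ → ∀ (a b : FPS) → comp (a ⊛ b) h ≈ₛ (comp a h ⊛ comp b h)
comp-⊛ h₀≡0 a b n = trans (comp-⊛-coeff h₀≡0 a b n) (sym (comp⊛comp-coeff h₀≡0 a b n))

pow-comp : ∀ {h : FPS} → h 0 ≡ 0ℤ → ∀ (a : FPS) k → pow (comp a h) k ≈ₛ comp (pow a k) h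
pow-comp {h} h₀≡0 a zero    = ≈ₛ-sym (oneS-comp h)
pow-comp {h} h₀≡0 a (suc k) =
  ≈ₛ-trans (⊛-congˡ (comp a h) (pow-comp h₀≡0 a k)) (≈ₛ-sym (comp-⊛ h₀≡0 a (pow a k)))

comp-assoc : ∀ {b c : FPS} → b 0 ≡ 0ℤ → c 0 ≡ 0ℤ → ∀ (a : FPS) → comp (comp a b) c ≈ₛ comp a (comp b c)
comp-assoc {b} {c} b₀≡0 c₀≡0 a n = begin
    sumUpTo n (λ m → sumUpTo m (λ k → a k * pow b k m) * pow c m n)
  ≡⟨ sumUpTo-cong′ n (λ m → sumUpTo-* m (pow c m n) _) ⟩
    sumUpTo n (λ m → sumUpTo m (λ k → a k * pow b k m * pow c m n))
  ≡⟨ sumUpTo-cong n (λ m m≤n → sumUpTo-extend m n m≤n (λ k m<k _ →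
       *-zeroˡ-≡ (pow c m n) (*-zeroʳ-≡ (a k) (pow-vanishes b₀≡0 k m m<k)))) ⟨
    sumUpTo n (λ m → sumUpTo n (λ k → a k * pow b k m * pow c m n))
  ≡⟨ sumUpTo-swap n n _ ⟩
    sumUpTo n (λ k → sumUpTo n (λ m → a k * pow b k m * pow c m n))
  ≡⟨ sumUpTo-cong′ n (λ k → trans (sumUpTo-cong′ n (λ m → ℤP.*-assoc (a k) _ _)) (sym (*-sumUpTo n (a k) _))) ⟩
    sumUpTo n (λ k → a k * comp (pow b k) c n)
  ≡⟨ sumUpTo-cong′ n (λ k → cong (a k *_) (pow-comp c₀≡0 b k n)) ⟨
    comp a (comp b c) n ∎
  where open ≡-Reasoning

comp-⊛-powX : ∀ {h : FPS} → h 0 ≡ 0ℤ → ∀ (a : FPS) k → comp (a ⊛ pow X k) h ≈ₛ (comp a h ⊛ pow h k)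
comp-⊛-powX {h} h₀≡0 a k = ≈ₛ-trans (comp-⊛ h₀≡0 a (pow X k))
  (⊛-congˡ (comp a h) (≈ₛ-trans (≈ₛ-sym (pow-comp h₀≡0 X k)) (pow-cong (X-comp h₀≡0) k)))

AgreeBelow : ℕ → FPS → FPS → Set
AgreeBelow n a b = ∀ i → i <ℕ n → a i ≡ b i

⊛-agreeBelow : ∀ {n} {a a′ b b′ : FPS} → AgreeBelow n a a′ → AgreeBelow n b b′ → AgreeBelow n (a ⊛ b) (a′ ⊛ b′)
⊛-agreeBelow a≈a′ b≈b′ m m<n = sumUpTo-cong m (λ i i≤m →
  cong₂ _*_ (a≈a′ i (ℕP.≤-<-trans i≤m m<n)) (b≈b′ (m ∸ i) (ℕP.≤-<-trans (ℕP.m∸n≤m m i) m<n)))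

pow-agreeBelow : ∀ {n} {a a′ : FPS} → AgreeBelow n a a′ → ∀ k → AgreeBelow n (pow a k) (pow a′ k)
pow-agreeBelow a≈a′ zero    i _ = refl
pow-agreeBelow a≈a′ (suc k) = ⊛-agreeBelow a≈a′ (pow-agreeBelow a≈a′ k)

⊛-agreeAt : ∀ {n} {a a′ b b′ : FPS} → a 0 ≡ 0ℤ → a′ 0 ≡ 0ℤ → b 0 ≡ 0ℤ → b′ 0 ≡ 0ℤ →
  AgreeBelow n a a′ → AgreeBelow n b b′ → (a ⊛ b) n ≡ (a′ ⊛ b′) n
⊛-agreeAt {n} {a} {a′} {b} {b′} a₀≡0 a′₀≡0 b₀≡0 b′₀≡0 a≈a′ b≈b′ = sumUpTo-cong n term
  where
  term : ∀ i → i ≤ℕ n → a i * b (n ∸ i) ≡ a′ i * b′ (n ∸ i)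
  term zero _ = trans (*-zeroˡ-≡ (b n) a₀≡0) (sym (*-zeroˡ-≡ (b′ n) a′₀≡0))
  term (suc i) 1+i≤n with suc i ℕ.≟ n
  ... | yes refl = trans (*-zeroʳ-≡ (a (suc i)) (trans (cong b (ℕP.n∸n≡0 i)) b₀≡0))
                         (sym (*-zeroʳ-≡ (a′ (suc i)) (trans (cong b′ (ℕP.n∸n≡0 i)) b′₀≡0)))
  ... | no 1+i≢n = cong₂ _*_ (a≈a′ (suc i) (ℕP.≤∧≢⇒< 1+i≤n 1+i≢n)) (b≈b′ (n ∸ suc i) (∸-suc-< i 1+i≤n))

-- The k = 1 term of [xⁿ] h(z) is zₙ, while the terms k ≥ 2 only involve z₀, …, zₙ₋₁.
comp-injectiveʳ : ∀ {h z z′ : FPS} → h 0 ≡ 0ℤ → h 1 ≡ 1ℤ → z 0 ≡ 0ℤ → z′ 0 ≡ 0ℤ →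
  comp h z ≈ₛ comp h z′ → z ≈ₛ z′
comp-injectiveʳ {h} {z} {z′} h₀≡0 h₁≡1 z₀≡0 z′₀≡0 h∘z≈h∘z′ = <-rec (λ n → z n ≡ z′ n) step
  where
  step : ∀ n → (∀ {m} → m <ℕ n → z m ≡ z′ m) → z n ≡ z′ n
  step zero    _     = trans z₀≡0 (sym z′₀≡0)
  step (suc m) agree = begin
      z n                      ≡⟨ ⊛-identityʳ z n ⟨
      pow z 1 n                ≡⟨ ℤP.*-identityˡ _ ⟨
      1ℤ * pow z 1 n           ≡⟨ cong (_* pow z 1 n) h₁≡1 ⟨
      h 1 * pow z 1 n          ≡⟨ sumUpTo-cancel-except n 1 (s≤s z≤n) sameTerm (h∘z≈h∘z′ n) ⟩
      h 1 * pow z′ 1 n         ≡⟨ cong (_* pow z′ 1 n) h₁≡1 ⟩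
      1ℤ * pow z′ 1 n          ≡⟨ ℤP.*-identityˡ _ ⟩
      pow z′ 1 n               ≡⟨ ⊛-identityʳ z′ n ⟩
      z′ n ∎
    where
    open ≡-Reasoning
    n = suc m
    sameTerm : ∀ k → k ≤ℕ n → k ≢ 1 → h k * pow z k n ≡ h k * pow z′ k n
    sameTerm zero          _ _   = refl
    sameTerm (suc zero)    _ 1≢1 = ⊥-elim (1≢1 refl)
    sameTerm (suc (suc j)) _ _   = cong (h (suc (suc j)) *_)
      (⊛-agreeAt z₀≡0 z′₀≡0 (*-zeroˡ-≡ (pow z j 0) z₀≡0) (*-zeroˡ-≡ (pow z′ j 0) z′₀≡0)
                 (λ i i<n → agree i<n) (pow-agreeBelow (λ i i<n → agree i<n) (suc j)))

reversion-comp : ∀ {u h : FPS} → h 0 ≡ 0ℤ → h 1 ≡ 1ℤ → IsReversion u h → comp u h ≈ₛ X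
reversion-comp {u} {h} h₀≡0 h₁≡1 (u₀≡0 , h∘u≈X) =
  comp-injectiveʳ {h} h₀≡0 h₁≡1 (trans (comp-coeff-0 u h) u₀≡0) refl (begin
    comp h (comp u h)   ≈⟨ comp-assoc u₀≡0 h₀≡0 h ⟨
    comp (comp h u) h   ≈⟨ comp-congʳ h h∘u≈X ⟩
    comp X h            ≈⟨ X-comp h₀≡0 ⟩
    h                   ≈⟨ comp-X h ⟨
    comp h X            ∎)
  where open ≈ₛ-Reasoning

module Reversions {f t φ s q : FPS} (f₀≡1 : f 0 ≡ 1ℤ) (t⊛f≈X : (t ⊛ f) ≈ₛ X) (φ-rev : IsReversion φ t)
                  (s-rev : IsReversion s (φ ⊛ comp f φ)) (q⊛φ∘s≈X : (q ⊛ comp φ s) ≈ₛ X) where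

  fφ H : FPS
  fφ = comp f φ
  H  = φ ⊛ fφ

  φ₀≡0 : φ 0 ≡ 0ℤ
  φ₀≡0 = proj₁ φ-rev

  s₀≡0 : s 0 ≡ 0ℤ
  s₀≡0 = proj₁ s-rev

  H∘s≈X : comp H s ≈ₛ X
  H∘s≈X = proj₂ s-rev

  t₀≡0 : t 0 ≡ 0ℤ
  t₀≡0 = trans (sym (ℤP.*-identityʳ (t 0))) (trans (cong (t 0 *_) (sym f₀≡1)) (t⊛f≈X 0))

  t₁≡1 : t 1 ≡ 1ℤ
  t₁≡1 = begin
    t 1              ≡⟨ ℤP.*-identityʳ (t 1) ⟨
    t 1 * 1ℤ         ≡⟨ cong (t 1 *_) f₀≡1 ⟨
    t 1 * f 0        ≡⟨ ⊛-coeff-1 {t} f t₀≡0 ⟨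
    (t ⊛ f) 1        ≡⟨ t⊛f≈X 1 ⟩
    1ℤ               ∎
    where open ≡-Reasoning

  fφ₀≡1 : fφ 0 ≡ 1ℤ
  fφ₀≡1 = trans (comp-coeff-0 f φ) f₀≡1

  φ∘t≈X : comp φ t ≈ₛ X
  φ∘t≈X = reversion-comp {φ} {t} t₀≡0 t₁≡1 φ-rev

  φ≈X⊛fφ : φ ≈ₛ (X ⊛ fφ)
  φ≈X⊛fφ = begin
    φ                       ≈⟨ X-comp φ₀≡0 ⟨
    comp X φ                ≈⟨ comp-congʳ φ t⊛f≈X ⟨
    comp (t ⊛ f) φ          ≈⟨ comp-⊛ {φ} φ₀≡0 t f ⟩
    comp t φ ⊛ fφ           ≈⟨ ⊛-congʳ fφ (proj₂ φ-rev) ⟩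
    X ⊛ fφ                  ∎
    where open ≈ₛ-Reasoning

  H≈X⊛fφ² : H ≈ₛ (X ⊛ (fφ ⊛ fφ))
  H≈X⊛fφ² = ≈ₛ-trans (⊛-congʳ fφ φ≈X⊛fφ) (⊛-assoc X fφ fφ)

  H₀≡0 : H 0 ≡ 0ℤ
  H₀≡0 = *-zeroˡ-≡ (fφ 0) φ₀≡0

  H₁≡1 : H 1 ≡ 1ℤ
  H₁≡1 = trans (H≈X⊛fφ² 1) (trans (X⊛-suc (fφ ⊛ fφ) 0) (cong₂ _*_ fφ₀≡1 fφ₀≡1))

  s∘H≈X : comp s H ≈ₛ X
  s∘H≈X = reversion-comp {s} {H} H₀≡0 H₁≡1 s-rev

  H∘t≈X⊛f : comp H t ≈ₛ (X ⊛ f)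
  H∘t≈X⊛f = begin
    comp (φ ⊛ fφ) t             ≈⟨ comp-⊛ {t} t₀≡0 φ fφ ⟩
    comp φ t ⊛ comp fφ t        ≈⟨ ⊛-congʳ (comp fφ t) φ∘t≈X ⟩
    X ⊛ comp (comp f φ) t       ≈⟨ ⊛-congˡ X (comp-assoc φ₀≡0 t₀≡0 f) ⟩
    X ⊛ comp f (comp φ t)       ≈⟨ ⊛-congˡ X (≈ₛ-trans (comp-congˡ f φ∘t≈X) (comp-X f)) ⟩
    X ⊛ f                       ∎
    where open ≈ₛ-Reasoning

  q∘H≈fφ : comp q H ≈ₛ fφ
  q∘H≈fφ = ⊛-cancelʳ {comp q H} {fφ} {fφ} fφ₀≡1 (X⊛-cancel (begin
    X ⊛ (comp q H ⊛ fφ)              ≈⟨ x∙yz≈y∙xz X (comp q H) fφ ⟩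
    comp q H ⊛ (X ⊛ fφ)              ≈⟨ ⊛-congˡ (comp q H) φ≈X⊛fφ ⟨
    comp q H ⊛ φ                     ≈⟨ ⊛-congˡ (comp q H) φ∘s∘H≈φ ⟨
    comp q H ⊛ comp (comp φ s) H     ≈⟨ comp-⊛ {H} H₀≡0 q (comp φ s) ⟨
    comp (q ⊛ comp φ s) H            ≈⟨ comp-congʳ H q⊛φ∘s≈X ⟩
    comp X H                         ≈⟨ X-comp H₀≡0 ⟩
    H                                ≈⟨ H≈X⊛fφ² ⟩
    X ⊛ (fφ ⊛ fφ)                    ∎))
    where
    open ≈ₛ-Reasoning
    φ∘s∘H≈φ : comp (comp φ s) H ≈ₛ φ
    φ∘s∘H≈φ = ≈ₛ-trans (comp-assoc s₀≡0 H₀≡0 φ) (≈ₛ-trans (comp-congˡ φ s∘H≈X) (comp-X φ))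

  q≈fφ∘s : q ≈ₛ comp fφ s
  q≈fφ∘s = begin
    q                     ≈⟨ comp-X q ⟨
    comp q X              ≈⟨ comp-congˡ q H∘s≈X ⟨
    comp q (comp H s)     ≈⟨ comp-assoc H₀≡0 s₀≡0 q ⟨
    comp (comp q H) s     ≈⟨ comp-congʳ s q∘H≈fφ ⟩
    comp fφ s             ∎
    where open ≈ₛ-Reasoning

  q∘[X⊛f]≈f : comp q (X ⊛ f) ≈ₛ f
  q∘[X⊛f]≈f = begin
    comp q (X ⊛ f)         ≈⟨ comp-congˡ q H∘t≈X⊛f ⟨
    comp q (comp H t)      ≈⟨ comp-assoc H₀≡0 t₀≡0 q ⟨
    comp (comp q H) t      ≈⟨ comp-congʳ t q∘H≈fφ ⟩
    comp (comp f φ) t      ≈⟨ comp-assoc φ₀≡0 t₀≡0 f ⟩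
    comp f (comp φ t)      ≈⟨ comp-congˡ f φ∘t≈X ⟩
    comp f X               ≈⟨ comp-X f ⟩
    f                      ∎
    where open ≈ₛ-Reasoning

-- Riordan arrays

≈ₘ-setoid : Setoid 0ℓ 0ℓ
≈ₘ-setoid = record
  { Carrier       = Matrix
  ; _≈_           = _≈ₘ_
  ; isEquivalence = record
    { refl  = λ n k → refl
    ; sym   = λ M≈N n k → sym (M≈N n k)
    ; trans = λ M≈N N≈P n k → trans (M≈N n k) (N≈P n k)
    }
  }

open Setoid ≈ₘ-setoid using () renaming (sym to ≈ₘ-sym; trans to ≈ₘ-trans)

·-rowCongʳ : ∀ (N : Matrix) {M M′ : Matrix} n → (∀ j → M n j ≡ M′ n j) → ∀ k → (M · N) n k ≡ (M′ · N) n k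
·-rowCongʳ N n Mₙ≡M′ₙ k = sumUpTo-cong′ n (λ j → cong (_* N j k) (Mₙ≡M′ₙ j))

·-congʳ : ∀ (N : Matrix) {M M′ : Matrix} → M ≈ₘ M′ → (M · N) ≈ₘ (M′ · N)
·-congʳ N {M} {M′} M≈M′ n = ·-rowCongʳ N {M} {M′} n (M≈M′ n)

·-congˡ : ∀ (M : Matrix) {N N′ : Matrix} → N ≈ₘ N′ → (M · N) ≈ₘ (M · N′)
·-congˡ M N≈N′ n k = sumUpTo-cong′ n (λ j → cong (M n j *_) (N≈N′ j k))

riordan-cong : ∀ {d d′ h h′ : FPS} → d ≈ₛ d′ → h ≈ₛ h′ → riordan d h ≈ₘ riordan d′ h′
riordan-cong d≈d′ h≈h′ n k = ⊛-cong d≈d′ (pow-cong h≈h′ k) n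

riordan-oneS-X : riordan oneS X ≈ₘ idM
riordan-oneS-X n k = trans (⊛-identityˡ (pow X k) n) (pow-X k n)

riordan-lowerTriangular : ∀ {h : FPS} → h 0 ≡ 0ℤ → ∀ (d : FPS) → LowerTriangular (riordan d h)
riordan-lowerTriangular h₀≡0 d n k = ⊛-pow-vanishes h₀≡0 d k n

riordan-·-coeff : ∀ {h : FPS} → h 0 ≡ 0ℤ → ∀ (d : FPS) (N : Matrix) n k →
  (riordan d h · N) n k ≡ (d ⊛ comp (λ j → N j k) h) n
riordan-·-coeff h₀≡0 d N n k = sym (⊛-comp h₀≡0 d (λ j → N j k) n)

riordan-·-riordan : ∀ {h : FPS} → h 0 ≡ 0ℤ → ∀ (d u w : FPS) →
  (riordan d h · riordan u w) ≈ₘ riordan (d ⊛ comp u h) (comp w h)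
riordan-·-riordan {h} h₀≡0 d u w n k = trans (riordan-·-coeff h₀≡0 d (riordan u w) n k) (columnₖ n)
  where
  open ≈ₛ-Reasoning
  columnₖ : (d ⊛ comp (u ⊛ pow w k) h) ≈ₛ ((d ⊛ comp u h) ⊛ pow (comp w h) k)
  columnₖ = begin
    d ⊛ comp (u ⊛ pow w k) h               ≈⟨ ⊛-congˡ d (comp-⊛ h₀≡0 u (pow w k)) ⟩
    d ⊛ (comp u h ⊛ comp (pow w k) h)      ≈⟨ ⊛-congˡ d (⊛-congˡ (comp u h) (pow-comp h₀≡0 w k)) ⟨
    d ⊛ (comp u h ⊛ pow (comp w h) k)      ≈⟨ ⊛-assoc d (comp u h) (pow (comp w h) k) ⟨
    (d ⊛ comp u h) ⊛ pow (comp w h) k      ∎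

riordan-inverse-·ˡ : ∀ {h s e d : FPS} → h 0 ≡ 0ℤ → s 0 ≡ 0ℤ → comp h s ≈ₛ X → (e ⊛ d) ≈ₛ oneS →
  ∀ (u : FPS) → (riordan (comp e s) s · riordan (d ⊛ u) h) ≈ₘ riordan (comp u s) X
riordan-inverse-·ˡ {h} {s} {e} {d} h₀≡0 s₀≡0 h∘s≈X e⊛d≈1 u =
  ≈ₘ-trans (riordan-·-riordan s₀≡0 (comp e s) (d ⊛ u) h) (riordan-cong multiplier h∘s≈X)
  where
  open ≈ₛ-Reasoning
  multiplier : (comp e s ⊛ comp (d ⊛ u) s) ≈ₛ comp u s
  multiplier = begin
    comp e s ⊛ comp (d ⊛ u) s    ≈⟨ comp-⊛ s₀≡0 e (d ⊛ u) ⟨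
    comp (e ⊛ (d ⊛ u)) s         ≈⟨ comp-congʳ s (⊛-assoc e d u) ⟨
    comp ((e ⊛ d) ⊛ u) s         ≈⟨ comp-congʳ s (≈ₛ-trans (⊛-congʳ u e⊛d≈1) (⊛-identityˡ u)) ⟩
    comp u s                     ∎

riordan-inverse-·ʳ : ∀ {h s e d : FPS} → h 0 ≡ 0ℤ → s 0 ≡ 0ℤ → comp s h ≈ₛ X → (e ⊛ d) ≈ₛ oneS →
  ∀ (u : FPS) → (riordan (d ⊛ u) h · riordan (comp e s) s) ≈ₘ riordan u X
riordan-inverse-·ʳ {h} {s} {e} {d} h₀≡0 s₀≡0 s∘h≈X e⊛d≈1 u =
  ≈ₘ-trans (riordan-·-riordan h₀≡0 (d ⊛ u) (comp e s) s) (riordan-cong multiplier s∘h≈X)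
  where
  open ≈ₛ-Reasoning
  multiplier : ((d ⊛ u) ⊛ comp (comp e s) h) ≈ₛ u
  multiplier = begin
    (d ⊛ u) ⊛ comp (comp e s) h    ≈⟨ ⊛-congˡ (d ⊛ u) (comp-assoc s₀≡0 h₀≡0 e) ⟩
    (d ⊛ u) ⊛ comp e (comp s h)    ≈⟨ ⊛-congˡ (d ⊛ u) (≈ₛ-trans (comp-congˡ e s∘h≈X) (comp-X e)) ⟩
    (d ⊛ u) ⊛ e                    ≈⟨ xy∙z≈zx∙y d u e ⟩
    (e ⊛ d) ⊛ u                    ≈⟨ ⊛-congʳ u e⊛d≈1 ⟩
    oneS ⊛ u                       ≈⟨ ⊛-identityˡ u ⟩
    u                              ∎

-- The matrices c(A;r)

riordan-X⊛-suc : ∀ (g f : FPS) m N → (g ⊛ pow (X ⊛ f) (suc m)) (suc N) ≡ ((g ⊛ pow (X ⊛ f) m) ⊛ f) N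
riordan-X⊛-suc g f m N = trans (rearrange (suc N)) (X⊛-suc ((g ⊛ yᵐ) ⊛ f) N)
  where
  open ≈ₛ-Reasoning
  yᵐ = pow (X ⊛ f) m
  rearrange : (g ⊛ ((X ⊛ f) ⊛ yᵐ)) ≈ₛ (X ⊛ ((g ⊛ yᵐ) ⊛ f))
  rearrange = begin
    g ⊛ ((X ⊛ f) ⊛ yᵐ)     ≈⟨ ⊛-congˡ g (⊛-assoc X f yᵐ) ⟩
    g ⊛ (X ⊛ (f ⊛ yᵐ))     ≈⟨ x∙yz≈y∙xz g X (f ⊛ yᵐ) ⟩
    X ⊛ (g ⊛ (f ⊛ yᵐ))     ≈⟨ ⊛-congˡ X (⊛-congˡ g (⊛-comm f yᵐ)) ⟩
    X ⊛ (g ⊛ (yᵐ ⊛ f))     ≈⟨ ⊛-congˡ X (⊛-assoc g yᵐ f) ⟨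
    X ⊛ ((g ⊛ yᵐ) ⊛ f)     ∎

cMat-·-coeff : ∀ {y : FPS} → y 0 ≡ 0ℤ → ∀ (g : FPS) (N : Matrix) r n k →
  (cMat (riordan g y) r · N) n k ≡ ((g ⊛ pow y (n +ℕ r)) ⊛ comp (λ j → N j k) y) (2 *ℕ n +ℕ r)
cMat-·-coeff {y} y₀≡0 g N r n k = begin
    sumUpTo n (λ j → (g ⊛ pow y (n +ℕ j +ℕ r)) m * N j k)
  ≡⟨ sumUpTo-extend n m n≤m (λ j n<j _ →
       *-zeroˡ-≡ (N j k) (⊛-pow-vanishes y₀≡0 g (n +ℕ j +ℕ r) m (m<n+j+r n<j))) ⟨
    sumUpTo m (λ j → (g ⊛ pow y (n +ℕ j +ℕ r)) m * N j k)
  ≡⟨ sumUpTo-cong′ m (λ j → cong (_* N j k) (split j)) ⟩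
    sumUpTo m (λ j → (G ⊛ pow y j) m * N j k)
  ≡⟨ ⊛-comp y₀≡0 G (λ j → N j k) m ⟨
    (G ⊛ comp (λ j → N j k) y) m ∎
  where
  open ≡-Reasoning
  m = 2 *ℕ n +ℕ r
  G = g ⊛ pow y (n +ℕ r)
  n≤m : n ≤ℕ m
  n≤m = ℕP.≤-trans (ℕP.m≤m+n n (n +ℕ 0)) (ℕP.m≤m+n (2 *ℕ n) r)
  m<n+j+r : ∀ {j} → n <ℕ j → m <ℕ n +ℕ j +ℕ r
  m<n+j+r {j} n<j = ℕP.+-monoˡ-< r (subst (_<ℕ n +ℕ j) (cong (n +ℕ_) (sym (ℕP.+-identityʳ n))) (ℕP.+-monoʳ-< n n<j))
  regroup-index : ∀ n j r → n +ℕ j +ℕ r ≡ (n +ℕ r) +ℕ j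
  regroup-index = solve-∀
  split : ∀ j → (g ⊛ pow y (n +ℕ j +ℕ r)) m ≡ (G ⊛ pow y j) m
  split j = trans (cong (λ i → (g ⊛ pow y i) m) (regroup-index n j r))
    (trans (⊛-congˡ g (pow-+ y (n +ℕ r) j) m) (sym (⊛-assoc g (pow y (n +ℕ r)) (pow y j) m)))

cMat-·-riordanX : ∀ {f q : FPS} → comp q (X ⊛ f) ≈ₛ f → ∀ (g : FPS) r →
  (cMat (riordan g (X ⊛ f)) r · riordan q X) ≈ₘ cMat (riordan g (X ⊛ f)) (suc r)
cMat-·-riordanX {f} {q} q∘[X⊛f]≈f g r n k = begin
    (cMat (riordan g y) r · riordan q X) n k
  ≡⟨ cMat-·-coeff {y} refl g (riordan q X) r n k ⟩
    (G ⊛ comp (q ⊛ pow X k) y) m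
  ≡⟨ ⊛-congˡ G column m ⟩
    (G ⊛ (f ⊛ pow y k)) m
  ≡⟨ regroup m ⟩
    ((g ⊛ pow y (a +ℕ k)) ⊛ f) m
  ≡⟨ riordan-X⊛-suc g f (a +ℕ k) m ⟨
    (g ⊛ pow y (suc (a +ℕ k))) (suc m)
  ≡⟨ cong₂ (λ i j → (g ⊛ pow y j) i) (row-index n r) (column-index n k r) ⟨
    (g ⊛ pow y (n +ℕ k +ℕ suc r)) (2 *ℕ n +ℕ suc r) ∎
  where
  open ≡-Reasoning
  y = X ⊛ f
  m = 2 *ℕ n +ℕ r
  a = n +ℕ r
  G = g ⊛ pow y a
  row-index : ∀ n r → 2 *ℕ n +ℕ suc r ≡ suc (2 *ℕ n +ℕ r)
  row-index = solve-∀
  column-index : ∀ n k r → n +ℕ k +ℕ suc r ≡ suc ((n +ℕ r) +ℕ k)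
  column-index = solve-∀
  column : comp (q ⊛ pow X k) y ≈ₛ (f ⊛ pow y k)
  column = ≈ₛ-trans (comp-⊛-powX {y} refl q k) (⊛-congʳ (pow y k) q∘[X⊛f]≈f)
  regroup : (G ⊛ (f ⊛ pow y k)) ≈ₛ ((g ⊛ pow y (a +ℕ k)) ⊛ f)
  regroup = ≈ₛ-trans (x∙yz≈xz∙y G f (pow y k))
    (⊛-congʳ f (≈ₛ-trans (⊛-assoc g (pow y a) (pow y k)) (⊛-congˡ g (≈ₛ-sym (pow-+ y a k)))))

ShiftRecurrence : Matrix → Matrix → Set
ShiftRecurrence T E = ∀ n k → E (suc n) (suc k) ≡ ((E · T) · T) n k

shiftRecurrence-unique : ∀ {T E E′ : Matrix} → ShiftRecurrence T E → ShiftRecurrence T E′ →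
  (∀ n → E n 0 ≡ E′ n 0) → (∀ k → E 0 k ≡ E′ 0 k) → E ≈ₘ E′
shiftRecurrence-unique rec rec′ column row zero    k       = row k
shiftRecurrence-unique rec rec′ column row (suc n) zero    = column (suc n)
shiftRecurrence-unique {T} {E} {E′} rec rec′ column row (suc n) (suc k) = trans (rec n k) (trans
  (·-rowCongʳ T {E · T} {E′ · T} n (·-rowCongʳ T {E} {E′} n (shiftRecurrence-unique {T} {E} {E′} rec rec′ column row n)) k)
  (sym (rec′ n k)))

riordan-·-riordanX : ∀ {H p q : FPS} → H 0 ≡ 0ℤ → comp q H ≈ₛ p → ∀ (d : FPS) →
  (riordan d H · riordan q X) ≈ₘ riordan (d ⊛ p) H
riordan-·-riordanX {H} {p} {q} H₀≡0 q∘H≈p d =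
  ≈ₘ-trans (riordan-·-riordan H₀≡0 d q X) (riordan-cong (⊛-congˡ d q∘H≈p) (X-comp {H} H₀≡0))

riordan-shiftRecurrence : ∀ {H p q : FPS} → H 0 ≡ 0ℤ → comp q H ≈ₛ p → H ≈ₛ (X ⊛ (p ⊛ p)) → ∀ (d : FPS) →
  ShiftRecurrence (riordan q X) (riordan d H)
riordan-shiftRecurrence {H} {p} {q} H₀≡0 q∘H≈p H≈Xp² d n k = begin
    (d ⊛ (H ⊛ Hᵏ)) (suc n)
  ≡⟨ rearrange (suc n) ⟩
    (X ⊛ (((d ⊛ p) ⊛ p) ⊛ Hᵏ)) (suc n)
  ≡⟨ X⊛-suc (((d ⊛ p) ⊛ p) ⊛ Hᵏ) n ⟩
    riordan ((d ⊛ p) ⊛ p) H n k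
  ≡⟨ ≈ₘ-trans (·-congʳ (riordan q X) (riordan-·-riordanX {H} {p} {q} H₀≡0 q∘H≈p d))
              (riordan-·-riordanX {H} {p} {q} H₀≡0 q∘H≈p (d ⊛ p)) n k ⟨
    ((riordan d H · riordan q X) · riordan q X) n k ∎
  where
  open ≡-Reasoning
  Hᵏ = pow H k
  rearrange : (d ⊛ (H ⊛ Hᵏ)) ≈ₛ (X ⊛ (((d ⊛ p) ⊛ p) ⊛ Hᵏ))
  rearrange = ≈ₛ-trans (⊛-congˡ d (≈ₛ-trans (⊛-congʳ Hᵏ H≈Xp²) (⊛-assoc X (p ⊛ p) Hᵏ)))
    (≈ₛ-trans (x∙yz≈y∙xz d X ((p ⊛ p) ⊛ Hᵏ))
      (⊛-congˡ X (≈ₛ-trans (≈ₛ-sym (⊛-assoc d (p ⊛ p) Hᵏ)) (⊛-congʳ Hᵏ (≈ₛ-sym (⊛-assoc d p p))))))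

cMat-suc-suc : ∀ (A : Matrix) r n k → cMat A r (suc n) (suc k) ≡ cMat A (suc (suc r)) n k
cMat-suc-suc A r n k = cong₂ A (row-index n r) (column-index n k r)
  where
  row-index : ∀ n r → 2 *ℕ suc n +ℕ r ≡ 2 *ℕ n +ℕ suc (suc r)
  row-index = solve-∀
  column-index : ∀ n k r → suc n +ℕ suc k +ℕ r ≡ n +ℕ k +ℕ suc (suc r)
  column-index = solve-∀

cMat-shiftRecurrence : ∀ {f q : FPS} → comp q (X ⊛ f) ≈ₛ f → ∀ (g : FPS) r →
  ShiftRecurrence (riordan q X) (cMat (riordan g (X ⊛ f)) r)
cMat-shiftRecurrence {f} {q} q∘[X⊛f]≈f g r n k = trans (cMat-suc-suc A r n k)
  (≈ₘ-trans (≈ₘ-sym (cMat-·-riordanX {f} {q} q∘[X⊛f]≈f g (suc r)))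
            (·-congʳ (riordan q X) (≈ₘ-sym (cMat-·-riordanX {f} {q} q∘[X⊛f]≈f g r))) n k)
  where A = riordan g (X ⊛ f)

firstColumn : Matrix → FPS
firstColumn M n = M n 0

cMat-riordan : ∀ {f q H p : FPS} → comp q (X ⊛ f) ≈ₛ f → H 0 ≡ 0ℤ → comp q H ≈ₛ p → H ≈ₛ (X ⊛ (p ⊛ p)) →
  ∀ (g : FPS) r → let C = cMat (riordan g (X ⊛ f)) r in C ≈ₘ riordan (firstColumn C) H
cMat-riordan {f} {q} {H} {p} q∘[X⊛f]≈f H₀≡0 q∘H≈p H≈Xp² g r =
  shiftRecurrence-unique (cMat-shiftRecurrence {f} {q} q∘[X⊛f]≈f g r)
                         (riordan-shiftRecurrence {H} {p} {q} H₀≡0 q∘H≈p H≈Xp² (firstColumn C))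
    (λ n → sym (⊛-identityʳ (firstColumn C) n)) row₀
  where
  C = cMat (riordan g (X ⊛ f)) r
  row₀ : ∀ k → C 0 k ≡ riordan (firstColumn C) H 0 k
  row₀ zero    = sym (⊛-identityʳ (firstColumn C) 0)
  row₀ (suc k) = trans (⊛-pow-vanishes {X ⊛ f} refl g (suc k +ℕ r) r (s≤s (ℕP.m≤n+m r k)))
                       (sym (⊛-pow-vanishes {H} H₀≡0 (firstColumn C) (suc k) 0 (s≤s z≤n)))

cMat-corner : ∀ {g f : FPS} → g 0 ≡ 1ℤ → f 0 ≡ 1ℤ → ∀ r → cMat (riordan g (X ⊛ f)) r 0 0 ≡ 1ℤ
cMat-corner {g} {f} g₀≡1 f₀≡1 r = trans (⊛-pow-diagonal {X ⊛ f} refl g r)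
  (cong₂ _*_ g₀≡1 (pow-diagonal {X ⊛ f} refl (trans (X⊛-suc f 0) f₀≡1) r))

mainTheorem17 : (g f : FPS) → g 0 ≡ 1ℤ → f 0 ≡ 1ℤ →
    (t φ s q : FPS) →
    (t ⊛ f) ≈ₛ X →
    IsReversion φ t →
    IsReversion s (φ ⊛ comp f φ) →
    (q ⊛ comp φ s) ≈ₛ X →
    (r : ℕ) →
    Σ Matrix (λ M →
      LowerTriangular M
      × (M · cMat (riordan g (X ⊛ f)) r) ≈ₘ idM
      × (cMat (riordan g (X ⊛ f)) r · M) ≈ₘ idM
      × (M · cMat (riordan g (X ⊛ f)) (suc r)) ≈ₘ riordan q X
      × (cMat (riordan g (X ⊛ f)) (suc r) · M) ≈ₘ riordan (comp f φ) X)
mainTheorem17 g f g₀≡1 f₀≡1 t φ s q t⊛f≈X φ-rev s-rev q⊛φ∘s≈X r =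
  M , riordan-lowerTriangular s₀≡0 (comp e s)
    , ≈ₘ-trans (·-congˡ M Cᵣ≈) (≈ₘ-trans (M·riordan oneS) (≈ₘ-trans (riordan-cong (oneS-comp s) ≈ₛ-refl) riordan-oneS-X))
    , ≈ₘ-trans (·-congʳ M Cᵣ≈) (≈ₘ-trans (riordan·M oneS) riordan-oneS-X)
    , ≈ₘ-trans (·-congˡ M Cᵣ₊₁≈) (≈ₘ-trans (M·riordan fφ) (riordan-cong (≈ₛ-sym q≈fφ∘s) ≈ₛ-refl))
    , ≈ₘ-trans (·-congʳ M Cᵣ₊₁≈) (riordan·M fφ)
  where
  open Reversions {f} {t} {φ} {s} {q} f₀≡1 t⊛f≈X φ-rev s-rev q⊛φ∘s≈X
  C = cMat (riordan g (X ⊛ f))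
  D = firstColumn (C r)
  e = inv D
  M = riordan (comp e s) s
  e⊛D≈1 : (e ⊛ D) ≈ₛ oneS
  e⊛D≈1 = inv-⊛ D (cMat-corner {g} {f} g₀≡1 f₀≡1 r)
  M·riordan : ∀ u → (M · riordan (D ⊛ u) H) ≈ₘ riordan (comp u s) X
  M·riordan = riordan-inverse-·ˡ {H} {s} {e} {D} H₀≡0 s₀≡0 H∘s≈X e⊛D≈1
  riordan·M : ∀ u → (riordan (D ⊛ u) H · M) ≈ₘ riordan u X
  riordan·M = riordan-inverse-·ʳ {H} {s} {e} {D} H₀≡0 s₀≡0 s∘H≈X e⊛D≈1
  Cᵣ≈riordan : C r ≈ₘ riordan D H
  Cᵣ≈riordan = cMat-riordan {f} {q} {H} {fφ} q∘[X⊛f]≈f H₀≡0 q∘H≈fφ H≈X⊛fφ² g r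
  Cᵣ≈ : C r ≈ₘ riordan (D ⊛ oneS) H
  Cᵣ≈ = ≈ₘ-trans Cᵣ≈riordan (riordan-cong (≈ₛ-sym (⊛-identityʳ D)) ≈ₛ-refl)
  Cᵣ₊₁≈ : C (suc r) ≈ₘ riordan (D ⊛ fφ) H
  Cᵣ₊₁≈ = ≈ₘ-trans (≈ₘ-sym (cMat-·-riordanX {f} {q} q∘[X⊛f]≈f g r))
    (≈ₘ-trans (·-congʳ (riordan q X) Cᵣ≈riordan) (riordan-·-riordanX {H} {fφ} {q} H₀≡0 q∘H≈fφ D))
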